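{- Let $X$ be a set with a binary operation $\ast$ and an element $0\in X$ such that for all $x,y,z\in X$: (G) $((x\ast y)\ast z)\ast((x\ast(z\ast 0))\ast y)=0$, and (A3) if $x\ast y=0$ and $y\ast x=0$ then $x=y$. Then $x\ast 0 = x$ for all $x\in X$. -}

module Submission where

-- Write x ≼ y for x ∗ y ≡ 0#: then (G) says (x ∗ y) ∗ z ≼ (x ∗ (z ∗ 0#)) ∗ y and (A3) is
-- antisymmetry. Every step instantiates (G) and replaces subterms already known to vanish
-- by 0#. The crux is 0# ∗ 0# ≡ 0#. After it, ρ x (which is x when ∗ is subtraction in an
-- abelian group) vanishes as soon as x ≼ 0#, and this gives
-- x ≼ 0# → x ≡ 0#. That turns the instances of (G) with z = 0# and with y = 0# into the rules
-- x ∗ 0# ≼ y → x ≼ y and x ≼ z ∗ 0# → x ∗ 0# ≼ z. Alternating them, starting from the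
-- instance (x ∗ 0#) ∗ 0# ≼ (x ∗ 0#) ∗ 0#, yields x ≼ x ∗ 0# and x ∗ 0# ≼ x.

open import Level using (Level)
open import Data.Product using (Σ; _,_)
open import Relation.Binary.PropositionalEquality using (_≡_; sym; cong; subst; module ≡-Reasoning)

module Consequences {a : Level} {X : Set a} (_∗_ : X → X → X) (0# : X)
  (G : ∀ x y z → (((x ∗ y) ∗ z) ∗ ((x ∗ (z ∗ 0#)) ∗ y)) ≡ 0#)
  (antisym : ∀ x y → (x ∗ y) ≡ 0# → (y ∗ x) ≡ 0# → x ≡ y) where

  infix 4 _≼_
  _≼_ : X → X → Set a
  x ≼ y = x ∗ y ≡ 0#

  vanish : ∀ (C : X → X) {t} → t ≡ 0# → C t ≡ 0# → C 0# ≡ 0#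
  vanish C t≡0 = subst (λ h → C h ≡ 0#) t≡0

  ≼-≼0⇒0≼ : ∀ {x y z} → x ∗ y ≼ z → z ≼ 0# → 0# ≼ (x ∗ 0#) ∗ y
  ≼-≼0⇒0≼ {x} {y} {z} xy≼z z≼0 =
    vanish (λ h → 0# ∗ ((x ∗ h) ∗ y)) z≼0
      (vanish (λ h → h ∗ ((x ∗ (z ∗ 0#)) ∗ y)) xy≼z (G x y z))

  ≼⇒≼0 : ∀ {x y z} → x ∗ (z ∗ 0#) ≼ y → (x ∗ y) ∗ z ≼ 0#
  ≼⇒≼0 {x} {y} {z} x[z∗0]≼y = vanish (λ h → ((x ∗ y) ∗ z) ∗ h) x[z∗0]≼y (G x y z)

  ≼∗0⇒0∗≼0∗ : ∀ {p w} → p ≼ w ∗ 0# → 0# ∗ w ≼ 0# ∗ (w ∗ 0#)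
  ≼∗0⇒0∗≼0∗ {p} {w} p≼w∗0 =
    vanish (λ h → (h ∗ w) ∗ (h ∗ (w ∗ 0#))) p≼w∗0 (G p (w ∗ 0#) w)

  ∃≼0 : Σ X (_≼ 0#)
  ∃≼0 = _ , ≼⇒≼0 (G 0# 0# (0# ∗ 0#))

  ρ : X → X
  ρ x = 0# ∗ (0# ∗ ((x ∗ 0#) ∗ 0#))

  ρx∗x≼0 : ∀ x → ρ x ∗ x ≼ 0#
  ρx∗x≼0 x with ∃≼0
  ... | z , z≼0 =
    ≼⇒≼0 (≼∗0⇒0∗≼0∗ (vanish (λ h → ((x ∗ 0#) ∗ z) ∗ ((x ∗ h) ∗ 0#)) z≼0 (G x 0# z)))

  0∗0≡0 : 0# ∗ 0# ≡ 0#
  0∗0≡0 = antisym (0# ∗ 0#) 0# 0∗0≼0 0≼0∗0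
    where
    r s : X
    r = ρ 0#
    s = 0# ∗ r

    0∗[0∗0]∗r≼0 : (0# ∗ (0# ∗ 0#)) ∗ r ≼ 0#
    0∗[0∗0]∗r≼0 = vanish (λ h → ((0# ∗ (0# ∗ h)) ∗ r) ∗ 0#) (ρx∗x≼0 0#) (ρx∗x≼0 r)

    0≼s∗0∗0 : 0# ≼ (s ∗ 0#) ∗ 0#
    0≼s∗0∗0 = ≼-≼0⇒0≼ (G 0# r 0#) 0∗[0∗0]∗r≼0

    0∗0∗s≼0 : (0# ∗ 0#) ∗ s ≼ 0#
    0∗0∗s≼0 = vanish (λ h → ((0# ∗ h) ∗ s) ∗ 0#) 0≼s∗0∗0 (ρx∗x≼0 s)

    0≼0∗0 : 0# ≼ 0# ∗ 0#
    0≼0∗0 = vanish (λ h → 0# ∗ (0# ∗ h)) 0≼s∗0∗0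
              (vanish (λ h → 0# ∗ (h ∗ (0# ∗ ((s ∗ 0#) ∗ 0#)))) 0∗0∗s≼0
                (≼-≼0⇒0≼ (G (0# ∗ 0#) s (0# ∗ ((s ∗ 0#) ∗ 0#))) (≼⇒≼0 (G 0# 0# (s ∗ 0#)))))

    0∗0≼0 : 0# ∗ 0# ≼ 0#
    0∗0≼0 = vanish (λ h → (0# ∗ 0#) ∗ h) 0≼0∗0
              (vanish (λ h → (h ∗ 0#) ∗ (h ∗ (0# ∗ 0#))) 0≼0∗0 (G 0# (0# ∗ 0#) 0#))

  ≼0⇒≡0 : ∀ {x} → x ≼ 0# → x ≡ 0#
  ≼0⇒≡0 {x} x≼0 = antisym x 0# x≼0 (antisym (0# ∗ x) 0# 0∗x≼0 0≼0∗x)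
    where
    open ≡-Reasoning

    ρx≡0 : ρ x ≡ 0#
    ρx≡0 = begin
      0# ∗ (0# ∗ ((x ∗ 0#) ∗ 0#)) ≡⟨ cong (λ h → 0# ∗ (0# ∗ (h ∗ 0#))) x≼0 ⟩
      0# ∗ (0# ∗ (0# ∗ 0#))       ≡⟨ cong (λ h → 0# ∗ (0# ∗ h)) 0∗0≡0 ⟩
      0# ∗ (0# ∗ 0#)              ≡⟨ cong (0# ∗_) 0∗0≡0 ⟩
      0# ∗ 0#                     ≡⟨ 0∗0≡0 ⟩
      0#                          ∎

    0∗x≼0 : 0# ∗ x ≼ 0#
    0∗x≼0 = subst (λ h → h ∗ x ≼ 0#) ρx≡0 (ρx∗x≼0 x)

    0≼0∗x : 0# ≼ 0# ∗ x
    0≼0∗x = subst (λ h → 0# ≼ h ∗ x) 0∗0≡0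
              (subst (λ h → 0# ≼ (h ∗ 0#) ∗ x) ρx≡0 (≼-≼0⇒0≼ (ρx∗x≼0 x) 0∗0≡0))

  ∗0≼⇒≼ : ∀ {x y} → x ∗ 0# ≼ y → x ≼ y
  ∗0≼⇒≼ {x} {y} x∗0≼y =
    ≼0⇒≡0 (≼0⇒≡0 (≼⇒≼0 (subst (λ h → x ∗ h ≼ y) (sym 0∗0≡0) x∗0≼y)))

  ≼∗0⇒∗0≼ : ∀ {x z} → x ≼ z ∗ 0# → x ∗ 0# ≼ z
  ≼∗0⇒∗0≼ {x} {z} x≼z∗0 =
    ≼0⇒≡0 (vanish (λ h → ((x ∗ 0#) ∗ z) ∗ h) 0∗0≡0
      (vanish (λ h → ((x ∗ 0#) ∗ z) ∗ (h ∗ 0#)) x≼z∗0 (G x 0# z)))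

  x∗0≡x : ∀ x → x ∗ 0# ≡ x
  x∗0≡x x = antisym (x ∗ 0#) x (≼∗0⇒∗0≼ x≼x∗0) x≼x∗0
    where
    x∗0∗0≼x∗0∗0 : (x ∗ 0#) ∗ 0# ≼ (x ∗ 0#) ∗ 0#
    x∗0∗0≼x∗0∗0 = subst (λ h → (x ∗ 0#) ∗ 0# ≼ (x ∗ h) ∗ 0#) 0∗0≡0 (G x 0# 0#)

    x≼x∗0 : x ≼ x ∗ 0#
    x≼x∗0 = ∗0≼⇒≼ (≼∗0⇒∗0≼ (∗0≼⇒≼ (∗0≼⇒≼ x∗0∗0≼x∗0∗0)))

lemma7 : ∀ {a : Level} (X : Set a) (_∗_ : X → X → X) (0# : X) →
           (∀ x y z → (((x ∗ y) ∗ z) ∗ ((x ∗ (z ∗ 0#)) ∗ y)) ≡ 0#) →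
           (∀ x y → (x ∗ y) ≡ 0# → (y ∗ x) ≡ 0# → x ≡ y) →
           ∀ x → (x ∗ 0#) ≡ x
lemma7 X _∗_ 0# G antisym = Consequences.x∗0≡x _∗_ 0# G antisym
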